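{- Let $\bar G$ be a biconnected triangulated planar embedded graph and let $R$ be a connected region of $\bar G$. Let $R'$ be the graph obtained from $R$ by triangulating each hole $h$ of $R$: place a new (artificial) vertex $x_h$ inside $h$ and connect it by new (artificial) edges to all occurrences of vertices on the boundary of $h$. Then $R'$ is biconnected.
   Context: A region of $\bar G$ is an edge-induced subgraph of $\bar G$ with the inherited embedding. A face of $R$ is natural if it is also a face of $\bar G$, and is a hole of $R$ otherwise. A graph is biconnected if every pair of vertices is connected by at least two internally vertex-disjoint paths. -}

module Defs where

open import Data.Nat using (ℕ; zero; suc; _+_; _*_; _≤_; _≤ᵇ_)
open import Data.Fin using (Fin; toℕ)
open import Data.Bool using (Bool; true; false; if_then_else_)
open import Data.List using (List; []; _∷_; upTo; allFin; map)
open import Data.Bool.ListAction using (all)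
open import Data.Nat.ListAction using (sum)
open import Data.List.Membership.Propositional using (_∈_)
open import Data.List.Relation.Unary.Unique.Propositional using (Unique)
open import Data.Product using (Σ; ∃; ∃-syntax; _×_; _,_)
open import Data.Sum using (_⊎_; inj₁; inj₂)
open import Data.Empty using (⊥)
open import Relation.Nullary using (¬_)
open import Relation.Binary.PropositionalEquality using (_≡_; _≢_)

iter : {A : Set} → (A → A) → ℕ → A → A
iter f zero    x = x
iter f (suc k) x = f (iter f k x)

SameOrbit : {A : Set} → (A → A) → A → A → Set
SameOrbit f x y = ∃[ k ] iter f k x ≡ y

-- Number of orbits of a permutation f of Fin n: count darts that are the
-- minimum of their orbit (every orbit of a permutation of Fin n is
-- exhausted by the first n iterates).
isOrbitMin : {n : ℕ} → (Fin n → Fin n) → Fin n → Bool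
isOrbitMin {n} f d = all (λ k → toℕ d ≤ᵇ toℕ (iter f k d)) (upTo n)

numOrbits : {n : ℕ} → (Fin n → Fin n) → ℕ
numOrbits {n} f = sum (map (λ d → if isOrbitMin f d then 1 else 0) (allFin n))

data Walk {A : Set} (Adj : A → A → Set) : List A → A → A → Set where
  single : (u : A) → Walk Adj (u ∷ []) u u
  step   : {u w v : A} {xs : List A} → Adj u w → Walk Adj xs w v → Walk Adj (u ∷ xs) u v

IsPath : {A : Set} → (A → A → Set) → List A → A → A → Set
IsPath Adj xs u v = Walk Adj xs u v × Unique xs

InternallyDisjoint : {A : Set} → A → A → List A → List A → Set
InternallyDisjoint u v p q = ∀ x → x ∈ p → x ∈ q → (x ≡ u) ⊎ (x ≡ v)

Biconnected : {A : Set} → (Vtx : A → Set) → (A → A → Set) → Set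
Biconnected {A} Vtx Adj =
  (u v : A) → Vtx u → Vtx v → u ≢ v →
  Σ (List A) λ p → Σ (List A) λ q →
    IsPath Adj p u v × IsPath Adj q u v × p ≢ q × InternallyDisjoint u v p q

Connected : {A : Set} → (Vtx : A → Set) → (A → A → Set) → Set
Connected {A} Vtx Adj =
  (u v : A) → Vtx u → Vtx v → ∃[ xs ] Walk Adj xs u v

-- Embedded graphs as combinatorial maps (rotation systems).
-- Darts Fin n, vertices Fin V.  α pairs the two darts of an edge,
-- σ is the rotation (cyclic order of darts around their tail vertex),
-- vert d is the tail vertex of dart d; the vertices are exactly the
-- σ-orbits.  Faces are the orbits of φ = σ ∘ α.

record EmbeddedGraph : Set where
  field
    V n       : ℕ
    vert      : Fin n → Fin V
    α σ σ⁻    : Fin n → Fin n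
    α-invol   : ∀ d → α (α d) ≡ d
    α-fixfree : ∀ d → α d ≢ d
    σ-σ⁻      : ∀ d → σ (σ⁻ d) ≡ d
    σ⁻-σ      : ∀ d → σ⁻ (σ d) ≡ d
    vert-orb₁ : ∀ d e → vert d ≡ vert e → SameOrbit σ d e
    vert-orb₂ : ∀ d e → SameOrbit σ d e → vert d ≡ vert e
    vert-surj : ∀ v → ∃[ d ] vert d ≡ v

  φ : Fin n → Fin n
  φ d = σ (α d)

  Adj : Fin V → Fin V → Set
  Adj u v = ∃[ d ] (vert d ≡ u × vert (α d) ≡ v)

module _ (G : EmbeddedGraph) where
  open EmbeddedGraph G

  Simple : Set
  Simple = (∀ d → vert (α d) ≢ vert d)
         × (∀ d e → vert d ≡ vert e → vert (α d) ≡ vert (α e) → d ≡ e)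

  -- planar (genus 0): Euler's formula  V - E + F = 2  with E = n/2,
  -- written multiplied by 2 to stay in ℕ.
  Planar : Set
  Planar = 2 * V + 2 * numOrbits φ ≡ 4 + n

  Triangulated : Set
  Triangulated = ∀ d → (iter φ 3 d ≡ d) × (φ d ≢ d)

  -- Regions: edge-induced subgraphs (sets of darts closed under α)

  record Region : Set where
    field
      inR     : Fin n → Bool
      inR-sym : ∀ d → inR (α d) ≡ inR d

  module _ (R : Region) where
    open Region R

    -- inherited rotation: the next dart of R in the cyclic order around
    -- the vertex (search along σ, at most n steps)
    nextR : ℕ → Fin n → Fin n
    nextR zero    d = d
    nextR (suc k) d = if inR (σ d) then σ d else nextR k (σ d)

    σR : Fin n → Fin n
    σR d = nextR n d

    φR : Fin n → Fin n
    φR d = σR (α d)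

    RVertex : Fin V → Set
    RVertex v = ∃[ d ] (inR d ≡ true × vert d ≡ v)

    RAdj : Fin V → Fin V → Set
    RAdj u v = ∃[ d ] (inR d ≡ true × vert d ≡ u × vert (α d) ≡ v)

    ConnectedRegion : Set
    ConnectedRegion = Connected RVertex RAdj

    -- the face of R to which dart d belongs is natural: it is also a face
    -- of G (same boundary dart cycle)
    Natural : Fin n → Set
    Natural d = ∀ e → (SameOrbit φR d e → SameOrbit φ d e)
                    × (SameOrbit φ d e → SameOrbit φR d e)

    -- h represents a hole of R (canonical representative: minimal dart of
    -- the face of R)
    HoleRep : Fin n → Set
    HoleRep h = (inR h ≡ true)
              × (∀ e → SameOrbit φR h e → toℕ h ≤ toℕ e)
              × ¬ Natural h

    -- R' : vertices of R (inj₁) plus one artificial vertex x_h per hole h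
    -- (inj₂ h); x_h is joined to every vertex occurring on the boundary of h
    R'Vtx : Fin V ⊎ Fin n → Set
    R'Vtx (inj₁ v) = RVertex v
    R'Vtx (inj₂ h) = HoleRep h

    OnHole : Fin n → Fin V → Set
    OnHole h v = HoleRep h × ∃[ e ] (SameOrbit φR h e × vert e ≡ v)

    R'Adj : Fin V ⊎ Fin n → Fin V ⊎ Fin n → Set
    R'Adj (inj₁ u) (inj₁ v) = RAdj u v
    R'Adj (inj₂ h) (inj₁ v) = OnHole h v
    R'Adj (inj₁ v) (inj₂ h) = OnHole h v
    R'Adj (inj₂ _) (inj₂ _) = ⊥

module Submission where

-- (1) A graph-theoretic criterion (Whitney): a connected graph in which no
--     single vertex separates two others, and in which every edge uv has a
--     third vertex, is biconnected.  The two internally disjoint u–v paths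
--     are built by induction along a u–v walk (the classical "ear" argument).
--
-- (2) The completed region R′ satisfies the three hypotheses of (1):
--     * around a real vertex v, consecutive darts of R (in the inherited
--       rotation σᴿ) span a "corner", which is either a triangle of Ḡ kept
--       by R (its far edge lies in R) or part of a hole h (both ends are
--       joined to x_h); chaining corners links any two neighbours of v
--       without passing through v;
--     * around an artificial vertex x_h, the boundary walk of h links any
--       two neighbours of x_h inside R, hence avoiding x_h;
--     * a third vertex on an edge comes from the triangle or hole next to it.
--     The decisive fact is that a natural face of R is a triangle of Ḡ,
--     so a dart of R whose R-face is not a triangle of Ḡ lies on a hole.

open import Defs
open import Data.Unit using (⊤)
open import Data.Nat using (ℕ; zero; suc; _+_; _*_; _≤_; _<_; z≤n; s≤s; NonZero; _≤?_)
open import Data.Nat.Properties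
  using (+-comm; +-assoc; *-suc; ≤-refl; ≤-pred; suc-injective; ≤-trans; <⇒≤; ≰⇒>; m≤n+m; m≤n⇒m<n∨m≡n; <-cmp)
open import Data.Nat.DivMod using (_%_; _/_; m≡m%n+[m/n]*n; m%n<n)
open import Data.Fin using (Fin; toℕ)
import Data.Fin as Fin
open import Data.Fin.Properties using (pigeonhole; toℕ<n)
open import Data.Bool using (true; false)
open import Data.List using (List; []; _∷_; _++_; map)
open import Data.List.Properties using (++-assoc)
open import Data.List.Membership.Propositional using (_∈_; _∉_; lose)
open import Data.List.Membership.Propositional.Properties using (∈-++⁺ˡ; ∈-++⁺ʳ; ∈-++⁻; ∈-insert; ∈-∃++)
import Data.List.Membership.DecPropositional as DecMembership
open import Data.List.Relation.Unary.Any using (Any; here; there)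
open import Data.List.Relation.Unary.All.Properties using (¬Any⇒All¬)
open import Data.List.Relation.Unary.AllPairs using ([]; _∷_)
open import Data.List.Relation.Unary.Unique.Propositional using (Unique)
open import Data.List.Relation.Unary.Unique.Propositional.Properties using (++⁺; Unique[x∷xs]⇒x∉xs)
open import Data.Product using (Σ; _×_; _,_; proj₁; proj₂)
open import Data.Sum using (_⊎_; inj₁; inj₂; [_,_]; swap)
open import Data.Sum.Properties using (inj₁-injective; ≡-dec)
open import Data.Empty using (⊥; ⊥-elim)
open import Relation.Nullary using (¬_; Dec; yes; no)
open import Relation.Nullary.Decidable using (_×-dec_; _⊎-dec_)
open import Relation.Binary using (tri<; tri≈; tri>)
open import Relation.Binary.Definitions using (DecidableEquality)
open import Relation.Binary.PropositionalEquality using (_≡_; _≢_; refl; sym; trans; cong; subst; subst₂; module ≡-Reasoning)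

module _ {A : Set} where

  Unique-∷ : {x : A} {xs : List A} → x ∉ xs → Unique xs → Unique (x ∷ xs)
  Unique-∷ {xs = xs} x∉xs u = ¬Any⇒All¬ xs x∉xs ∷ u

  Unique-tail : {x : A} {xs : List A} → Unique (x ∷ xs) → Unique xs
  Unique-tail (_ ∷ u) = u

  Unique-++⁻ˡ : (xs : List A) {ys : List A} → Unique (xs ++ ys) → Unique xs
  Unique-++⁻ˡ []       u = []
  Unique-++⁻ˡ (x ∷ xs) u =
    Unique-∷ (λ m → Unique[x∷xs]⇒x∉xs u (∈-++⁺ˡ m)) (Unique-++⁻ˡ xs (Unique-tail u))

  Unique-++⁻ʳ : (xs : List A) {ys : List A} → Unique (xs ++ ys) → Unique ys
  Unique-++⁻ʳ []       u = u
  Unique-++⁻ʳ (x ∷ xs) u = Unique-++⁻ʳ xs (Unique-tail u)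

  Unique-++-disjoint : (xs : List A) {ys : List A} {z : A} → Unique (xs ++ ys) → z ∈ xs → z ∉ ys
  Unique-++-disjoint (x ∷ xs) u (here refl) m = Unique[x∷xs]⇒x∉xs u (∈-++⁺ʳ xs m)
  Unique-++-disjoint (x ∷ xs) u (there p)   m = Unique-++-disjoint xs (Unique-tail u) p m

  splitAtFirst : {P : A → Set} → ((x : A) → Dec (P x)) → (xs : List A) → Any P xs →
    Σ (List A) λ ys → Σ A λ y → Σ (List A) λ zs →
      (xs ≡ ys ++ y ∷ zs) × P y × (∀ z → z ∈ ys → ¬ P z)
  splitAtFirst P? (x ∷ xs) any with P? x | any
  ... | yes px | _        = [] , x , xs , refl , px , λ _ ()
  ... | no ¬px | here px  = ⊥-elim (¬px px)
  ... | no ¬px | there a with splitAtFirst P? xs a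
  ...   | ys , y , zs , refl , py , before = x ∷ ys , y , zs , refl , py , before′
    where
      before′ : ∀ z → z ∈ x ∷ ys → _
      before′ z (here refl) = ¬px
      before′ z (there m)   = before z m

WalkAvoiding : {A : Set} → (A → A → Set) → A → A → A → Set
WalkAvoiding {A} Adj w x y = Σ (List A) λ xs → Walk Adj xs x y × w ∉ xs

module Walks {A : Set} {Adj : A → A → Set} where

  source∈ : {xs : List A} {a b : A} → Walk Adj xs a b → a ∈ xs
  source∈ (single _) = here refl
  source∈ (step _ _) = here refl

  target∈ : {xs : List A} {a b : A} → Walk Adj xs a b → b ∈ xs
  target∈ (single _) = here refl
  target∈ (step _ w) = there (target∈ w)

  walk-head : {xs : List A} {a b : A} → Walk Adj xs a b → Σ (List A) λ ys → xs ≡ a ∷ ys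
  walk-head (single _) = _ , refl
  walk-head (step _ _) = _ , refl

  _++ᵂ_ : {xs ys : List A} {a b c : A} → Walk Adj xs a b → Walk Adj (b ∷ ys) b c → Walk Adj (xs ++ ys) a c
  single _ ++ᵂ w = w
  step e w₁ ++ᵂ w = step e (w₁ ++ᵂ w)

  concatWalks : {xs ys : List A} {a b c : A} → Walk Adj xs a b → Walk Adj ys b c →
    Σ (List A) λ zs → Walk Adj zs a c × (∀ z → z ∈ zs → z ∈ xs ⊎ z ∈ ys)
  concatWalks {xs} w₁ w₂ with walk-head w₂
  ... | ys , refl = xs ++ ys , w₁ ++ᵂ w₂ , occurs
    where
      occurs : ∀ z → z ∈ xs ++ ys → _
      occurs z m with ∈-++⁻ xs m
      ... | inj₁ m₁ = inj₁ m₁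
      ... | inj₂ m₂ = inj₂ (there m₂)

  _++ᴬ_ : ∀ {w a b c} → WalkAvoiding Adj w a b → WalkAvoiding Adj w b c → WalkAvoiding Adj w a c
  (xs , w₁ , w∉xs) ++ᴬ (ys , w₂ , w∉ys) with concatWalks w₁ w₂
  ... | zs , w₃ , occurs = zs , w₃ , λ m → [ w∉xs , w∉ys ] (occurs _ m)

  module _ (Adj-sym : ∀ {a b} → Adj a b → Adj b a) where

    reverseWalk : {xs : List A} {a b : A} → Walk Adj xs a b →
      Σ (List A) λ ys → Walk Adj ys b a × (∀ z → z ∈ ys → z ∈ xs)
    reverseWalk (single a) = a ∷ [] , single a , λ z m → m
    reverseWalk (step {u} e w) with reverseWalk w
    ... | ys , w′ , sub with concatWalks w′ (step (Adj-sym e) (single u))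
    ...   | zs , w″ , occurs = zs , w″ , λ z m → [ (λ m₁ → there (sub z m₁)) , lastEdge z ] (occurs z m)
      where
        lastEdge : ∀ z → z ∈ _ ∷ u ∷ [] → z ∈ u ∷ _
        lastEdge z (here refl)         = there (source∈ w)
        lastEdge z (there (here refl)) = here refl

    reverseAvoiding : ∀ {w a b} → WalkAvoiding Adj w a b → WalkAvoiding Adj w b a
    reverseAvoiding (xs , walk , w∉xs) with reverseWalk walk
    ... | ys , walk′ , sub = ys , walk′ , λ m → w∉xs (sub _ m)

  suffix : (ys : List A) {y : A} {zs : List A} {a b : A} → Walk Adj (ys ++ y ∷ zs) a b → Walk Adj (y ∷ zs) y b
  suffix []           (single _) = single _
  suffix []           (step e w) = step e w
  suffix (x ∷ [])     (step e w) = suffix [] w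
  suffix (x ∷ x′ ∷ ys) (step e w) = suffix (x′ ∷ ys) w

  prefix : (ys : List A) {y : A} {zs : List A} {a b : A} → Walk Adj (ys ++ y ∷ zs) a b → Walk Adj (ys ++ y ∷ []) a y
  prefix []           (single _)          = single _
  prefix []           (step e w)          = single _
  prefix (x ∷ [])     (step e (single _)) = step e (single _)
  prefix (x ∷ [])     (step e (step _ _)) = step e (single _)
  prefix (x ∷ x′ ∷ ys) (step e w)          = step e (prefix (x′ ∷ ys) w)

  splice : (ys : List A) {y : A} {zs : List A} {a b : A} →
    Walk Adj (ys ++ y ∷ []) a y → Walk Adj (y ∷ zs) y b → Walk Adj (ys ++ y ∷ zs) a b
  splice ys {y} {zs} w₁ w₂ = subst (λ xs → Walk Adj xs _ _) (++-assoc ys (y ∷ []) zs) (w₁ ++ᵂ w₂)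

  shortenWalk : {xs : List A} {a b : A} → DecidableEquality A → Walk Adj xs a b →
    Σ (List A) λ ys → IsPath Adj ys a b × (∀ z → z ∈ ys → z ∈ xs)
  shortenWalk _≟_ (single a) = a ∷ [] , (single a , Unique-∷ (λ ()) []) , λ z m → m
  shortenWalk _≟_ (step {u} e w) with shortenWalk _≟_ w
  ... | ys , (wy , uy) , sub with DecMembership._∈?_ _≟_ u ys
  ... | no u∉ys = u ∷ ys , (step e wy , Unique-∷ u∉ys uy) , occurs
    where
      occurs : ∀ z → z ∈ u ∷ ys → z ∈ u ∷ _
      occurs z (here p)  = here p
      occurs z (there m) = there (sub z m)
  ... | yes u∈ys with ∈-∃++ u∈ys
  ...   | ys₁ , ys₂ , refl = u ∷ ys₂ , (suffix ys₁ wy , Unique-++⁻ʳ ys₁ uy) , occurs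
    where
      occurs : ∀ z → z ∈ u ∷ ys₂ → z ∈ u ∷ _
      occurs z (here p)  = here p
      occurs z (there m) = there (sub z (∈-++⁺ʳ ys₁ (there m)))

open Walks

NoCutVertex : {A : Set} → (A → Set) → (A → A → Set) → Set
NoCutVertex Vtx Adj = ∀ w x y → Vtx x → Vtx y → x ≢ w → y ≢ w → WalkAvoiding Adj w x y

TwoDisjointPaths : {A : Set} → (A → A → Set) → A → A → Set
TwoDisjointPaths {A} Adj u v = Σ (List A) λ p → Σ (List A) λ q →
  IsPath Adj p u v × IsPath Adj q u v × p ≢ q × InternallyDisjoint u v p q

module Whitney {A : Set} (_≟_ : DecidableEquality A) (Vtx : A → Set) (Adj : A → A → Set)
  (adj-vertex : ∀ {a b} → Adj a b → Vtx b)
  (noCut : NoCutVertex Vtx Adj)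
  (thirdVertex : ∀ u v → Adj u v → Σ A λ z → Vtx z × z ≢ u × z ≢ v)
  (connected : Connected Vtx Adj) where

  private
    Two = TwoDisjointPaths Adj
    _∈?_ = DecMembership._∈?_ _≟_

  pathAvoiding : ∀ w x y → Vtx x → Vtx y → x ≢ w → y ≢ w →
    Σ (List A) λ xs → IsPath Adj xs x y × w ∉ xs
  pathAvoiding w x y vx vy x≢w y≢w with noCut w x y vx vy x≢w y≢w
  ... | xs , walk , w∉xs with shortenWalk _≟_ walk
  ...   | ys , path , sub = ys , path , λ m → w∉xs (sub w m)

  lists-differ : {p q : List A} {z : A} → z ∈ q → z ∉ p → p ≢ q
  lists-differ z∈q z∉p refl = z∉p z∈q

  swapPaths : ∀ {u v} → Two u v → Two u v
  swapPaths (p , q , pp , pq , p≢q , disj) = q , p , pq , pp , (λ eq → p≢q (sym eq)) , λ x a b → disj x b a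

  flipDisjoint : ∀ {u v : A} {p q : List A} → InternallyDisjoint u v p q → InternallyDisjoint u v q p
  flipDisjoint disj x a b = disj x b a

  notOnOther : ∀ {x u v : A} {p q : List A} → InternallyDisjoint u v p q → x ≢ u → x ≢ v → x ∈ p → x ∉ q
  notOnOther disj x≢u x≢v x∈p x∈q = [ x≢u , x≢v ] (disj _ x∈p x∈q)

  start∉rest : (P₁ : List A) {x w : A} {P₂ T : List A} → P₁ ++ x ∷ P₂ ≡ w ∷ T → x ≢ w →
    Unique (P₁ ++ x ∷ P₂) → w ∉ P₂
  start∉rest []       refl x≢w u m = x≢w refl
  start∉rest (a ∷ P₁) refl x≢w u m = Unique-++-disjoint (a ∷ P₁) u (here refl) (there m)

  -- adjacent u, v: the edge uv, and a path u → z → v through a third vertex z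
  adjacentCase : ∀ u v → Vtx u → Vtx v → u ≢ v → Adj u v → Two u v
  adjacentCase u v vu vv u≢v e with thirdVertex u v e
  ... | z , vz , z≢u , z≢v
    with pathAvoiding v u z vu vz u≢v z≢v | pathAvoiding u z v vz vv z≢u (λ eq → u≢v (sym eq))
  ... | P , (wP , uP) , v∉P | Q , (wQ , uQ) , u∉Q
    with splitAtFirst (_∈? Q) P (lose (target∈ wP) (source∈ wQ))
  ... | P₁ , y , P₂ , refl , y∈Q , firstMeet with ∈-∃++ y∈Q
  ... | Q₁ , Q₂ , refl =
    u ∷ v ∷ [] , P₁ ++ y ∷ Q₂ ,
    (step e (single v) , Unique-∷ (λ { (here eq) → u≢v eq ; (there ()) }) (Unique-∷ (λ ()) [])) ,
    (splice P₁ (prefix P₁ wP) (suffix Q₁ wQ) ,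
       ++⁺ (Unique-++⁻ˡ P₁ uP) (Unique-++⁻ʳ Q₁ uQ)
           (λ (m₁ , m₂) → firstMeet _ m₁ (∈-++⁺ʳ Q₁ m₂))) ,
    lists-differ (∈-insert P₁) (λ { (here eq) → u∉Q (subst (_∈ Q₁ ++ y ∷ Q₂) eq (∈-insert Q₁))
                                  ; (there (here eq)) → v∉P (subst (_∈ P₁ ++ y ∷ P₂) eq (∈-insert P₁))
                                  ; (there (there ())) }) ,
    λ { x (here eq) _ → inj₁ eq ; x (there (here eq)) _ → inj₂ eq ; x (there (there ())) _ }

  -- Extension step.  Below, u ~ w, and P, Q are disjoint w–v paths.
  -- If u lies on P = P₁ ++ u ∷ P₂, take u ∷ P₂ and u ∷ Q.
  uOnPath : ∀ {u w v} → Adj u w → u ≢ w → u ≢ v → (P₁ P₂ Q : List A) →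
    IsPath Adj (P₁ ++ u ∷ P₂) w v → IsPath Adj Q w v →
    InternallyDisjoint w v (P₁ ++ u ∷ P₂) Q → Two u v
  uOnPath {u} {w} {v} e u≢w u≢v P₁ P₂ Q (wP , uP) (wQ , uQ) disj with walk-head wP
  ... | _ , startP =
    u ∷ P₂ , u ∷ Q , (suffix P₁ wP , Unique-++⁻ʳ P₁ uP) ,
    (step e wQ , Unique-∷ (notOnOther disj u≢w u≢v (∈-insert P₁)) uQ) ,
    lists-differ (there (source∈ wQ)) (λ { (here eq) → u≢w (sym eq) ; (there m) → w∉P₂ m }) ,
    λ { x (here eq) _ → inj₁ eq
      ; x (there m) (here eq) → inj₁ eq
      ; x (there m) (there m′) → onBoth x m m′ }
    where
      w∉P₂ : w ∉ P₂
      w∉P₂ = start∉rest P₁ startP u≢w uP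
      onBoth : ∀ x → x ∈ P₂ → x ∈ Q → (x ≡ u) ⊎ (x ≡ v)
      onBoth x m m′ with disj x (∈-++⁺ʳ P₁ (there m)) m′
      ... | inj₁ refl = ⊥-elim (w∉P₂ m)
      ... | inj₂ eq   = inj₂ eq

  -- If u is on neither path, let D = D₁ ++ x ∷ D₂ be a u–v path avoiding w
  -- which meets P ∪ Q first at x, say x ∈ P = P₁ ++ x ∷ P₂; take the
  -- detour D₁ ++ x ∷ P₂ and u ∷ Q.
  detour : ∀ {u w v x} → Adj u w → u ≢ w → u ≢ v → x ≢ w → (P₁ P₂ Q D₁ D₂ : List A) →
    IsPath Adj (P₁ ++ x ∷ P₂) w v → IsPath Adj Q w v →
    InternallyDisjoint w v (P₁ ++ x ∷ P₂) Q →
    IsPath Adj (D₁ ++ x ∷ D₂) u v → w ∉ D₁ ++ x ∷ D₂ →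
    (∀ z → z ∈ D₁ → ¬ (z ∈ P₁ ++ x ∷ P₂ ⊎ z ∈ Q)) →
    u ∉ Q → Two u v
  detour {u} {w} {v} {x} e u≢w u≢v x≢w P₁ P₂ Q D₁ D₂ (wP , uP) (wQ , uQ) disj (wD , uD) w∉D firstMeet u∉Q
    with walk-head wP
  ... | _ , startP =
    D₁ ++ x ∷ P₂ , u ∷ Q ,
    (splice D₁ (prefix D₁ wD) (suffix P₁ wP) ,
      ++⁺ (Unique-++⁻ˡ D₁ uD) (Unique-++⁻ʳ P₁ uP) (λ (m₁ , m₂) → firstMeet _ m₁ (inj₁ (∈-++⁺ʳ P₁ m₂)))) ,
    (step e wQ , Unique-∷ u∉Q uQ) ,
    lists-differ (there (source∈ wQ)) w∉detour ,
    λ { z m (here eq) → inj₁ eq ; z m (there m′) → onBoth z m m′ }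
    where
      w∉P₂ : w ∉ P₂
      w∉P₂ = start∉rest P₁ startP x≢w uP
      w∉detour : w ∉ D₁ ++ x ∷ P₂
      w∉detour m with ∈-++⁻ D₁ m
      ... | inj₁ m₁         = w∉D (∈-++⁺ˡ m₁)
      ... | inj₂ (here eq)  = x≢w (sym eq)
      ... | inj₂ (there m₂) = w∉P₂ m₂
      onBoth : ∀ z → z ∈ D₁ ++ x ∷ P₂ → z ∈ Q → (z ≡ u) ⊎ (z ≡ v)
      onBoth z m m′ with ∈-++⁻ D₁ m
      ... | inj₁ m₁ = ⊥-elim (firstMeet z m₁ (inj₂ m′))
      ... | inj₂ m₂ with disj z (∈-++⁺ʳ P₁ m₂) m′
      ...   | inj₁ refl = ⊥-elim (w∉detour m)
      ...   | inj₂ eq   = inj₂ eq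

  extendAlongEdge : ∀ u w v → Vtx u → Vtx v → Adj u w → u ≢ w → u ≢ v → w ≢ v →
    (P Q : List A) → IsPath Adj P w v → IsPath Adj Q w v → InternallyDisjoint w v P Q → Two u v
  extendAlongEdge u w v vu vv e u≢w u≢v w≢v P Q pP pQ disj with u ∈? P | u ∈? Q
  ... | yes u∈P | _ with ∈-∃++ u∈P
  ...   | P₁ , P₂ , refl = uOnPath e u≢w u≢v P₁ P₂ Q pP pQ disj
  extendAlongEdge u w v vu vv e u≢w u≢v w≢v P Q pP pQ disj | no _ | yes u∈Q with ∈-∃++ u∈Q
  ...   | Q₁ , Q₂ , refl = swapPaths (uOnPath e u≢w u≢v Q₁ Q₂ P pQ pP (flipDisjoint disj))
  extendAlongEdge u w v vu vv e u≢w u≢v w≢v P Q pP pQ disj | no u∉P | no u∉Q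
    with pathAvoiding w u v vu vv u≢w (λ eq → w≢v (sym eq))
  ... | D , pD , w∉D
    with splitAtFirst (λ x → (x ∈? P) ⊎-dec (x ∈? Q)) D (lose (target∈ (proj₁ pD)) (inj₁ (target∈ (proj₁ pP))))
  ... | D₁ , x , D₂ , refl , onP∪Q , firstMeet = meet onP∪Q
    where
      x≢w : x ≢ w
      x≢w refl = w∉D (∈-insert D₁)
      meet : x ∈ P ⊎ x ∈ Q → Two u v
      meet (inj₁ x∈P) with ∈-∃++ x∈P
      ... | P₁ , P₂ , refl = detour e u≢w u≢v x≢w P₁ P₂ Q D₁ D₂ pP pQ disj pD w∉D firstMeet u∉Q
      meet (inj₂ x∈Q) with ∈-∃++ x∈Q
      ... | Q₁ , Q₂ , refl = swapPaths (detour e u≢w u≢v x≢w Q₁ Q₂ P D₁ D₂ pQ pP (flipDisjoint disj) pD w∉D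
                                          (λ z m h → firstMeet z m (swap h)) u∉P)

  disjointPathsAlong : ∀ {xs} u v → Vtx u → Vtx v → u ≢ v → Walk Adj xs u v → Two u v
  disjointPathsAlong u v vu vv u≢v (single _) = ⊥-elim (u≢v refl)
  disjointPathsAlong u v vu vv u≢v (step {w = w} e rest) with w ≟ u | w ≟ v
  ... | yes refl | _        = disjointPathsAlong u v vu vv u≢v rest
  ... | no _     | yes refl = adjacentCase u v vu vv u≢v e
  ... | no w≢u   | no w≢v with disjointPathsAlong w v (adj-vertex e) vv w≢v rest
  ...   | P , Q , pP , pQ , _ , disj = extendAlongEdge u w v vu vv e (λ eq → w≢u (sym eq)) u≢v w≢v P Q pP pQ disj

  biconnected : Biconnected Vtx Adj
  biconnected u v vu vv u≢v = disjointPathsAlong u v vu vv u≢v (proj₂ (connected u v vu vv))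

module _ {A : Set} (f : A → A) where

  iter-suc′ : ∀ k x → iter f (suc k) x ≡ iter f k (f x)
  iter-suc′ zero    x = refl
  iter-suc′ (suc k) x = cong f (iter-suc′ k x)

  iter-+ : ∀ a b x → iter f (a + b) x ≡ iter f a (iter f b x)
  iter-+ zero    b x = refl
  iter-+ (suc a) b x = cong f (iter-+ a b x)

  iter-period-* : ∀ p x → iter f p x ≡ x → ∀ q → iter f (q * p) x ≡ x
  iter-period-* p x periodic zero    = refl
  iter-period-* p x periodic (suc q) =
    trans (iter-+ p (q * p) x) (trans (cong (iter f p) (iter-period-* p x periodic q)) periodic)

  iter-period-% : ∀ p .{{_ : NonZero p}} x → iter f p x ≡ x → ∀ m → iter f m x ≡ iter f (m % p) x
  iter-period-% p x periodic m =
    trans (cong (λ t → iter f t x) (m≡m%n+[m/n]*n m p))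
      (trans (iter-+ (m % p) ((m / p) * p) x) (cong (iter f (m % p)) (iter-period-* p x periodic (m / p))))

  iter-cycle-forward : ∀ p x → iter f (suc p) x ≡ x → ∀ i j → iter f (j + i * p) (iter f i x) ≡ iter f j x
  iter-cycle-forward p x periodic i j = begin
    iter f (j + i * p) (iter f i x)   ≡⟨ iter-+ (j + i * p) i x ⟨
    iter f (j + i * p + i) x          ≡⟨ cong (λ t → iter f t x) (+-assoc j (i * p) i) ⟩
    iter f (j + (i * p + i)) x        ≡⟨ cong (λ t → iter f (j + t) x) (trans (+-comm (i * p) i) (sym (*-suc i p))) ⟩
    iter f (j + i * suc p) x          ≡⟨ iter-+ j (i * suc p) x ⟩
    iter f j (iter f (i * suc p) x)   ≡⟨ cong (iter f j) (iter-period-* (suc p) x periodic i) ⟩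
    iter f j x                        ∎
    where open ≡-Reasoning

  iter-preserves : (P : A → Set) → (∀ x → P x → P (f x)) → ∀ k x → P x → P (iter f k x)
  iter-preserves P closed zero    x px = px
  iter-preserves P closed (suc k) x px = closed _ (iter-preserves P closed k x px)

  iter-injective : (∀ x y → f x ≡ f y → x ≡ y) → ∀ k x y → iter f k x ≡ iter f k y → x ≡ y
  iter-injective inj zero    x y eq = eq
  iter-injective inj (suc k) x y eq = iter-injective inj k x y (inj _ _ eq)

<⇒≡+suc : {a b : ℕ} → a < b → Σ ℕ λ c → b ≡ a + suc c
<⇒≡+suc {zero}  {suc b} (s≤s z≤n) = b , refl
<⇒≡+suc {suc a} {suc b} (s≤s a<b) with <⇒≡+suc a<b
... | c , refl = c , refl

skip-bound : ∀ a c → 1 ≤ a → suc c < a + suc c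
skip-bound (suc a) c _ = s≤s (m≤n+m (suc c) a)

remainder≤ : ∀ {a c k} → 1 ≤ a → suc k ≡ a + suc c → suc c ≤ k
remainder≤ {suc a} {c} _ eq = subst (suc c ≤_) (sym (suc-injective eq)) (m≤n+m (suc c) a)

module _ {n : ℕ} (f : Fin n → Fin n) (P : Fin n → Set) (closed : ∀ x → P x → P (f x))
         (inj : ∀ x y → P x → P y → f x ≡ f y → x ≡ y) where

  cancelIterates : ∀ i d x → P x → iter f i x ≡ iter f (i + d) x → x ≡ iter f d x
  cancelIterates zero    d x px eq = eq
  cancelIterates (suc i) d x px eq =
    cancelIterates i d x px
      (inj _ _ (iter-preserves f P closed i x px) (iter-preserves f P closed (i + d) x px) eq)

  -- pigeonhole on the n + 1 points x, f x, …, fⁿ x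
  periodicPoint : ∀ x → P x → Σ ℕ λ p → (1 ≤ p) × (p ≤ n) × (iter f p x ≡ x)
  periodicPoint x px with pigeonhole ≤-refl (λ (i : Fin (suc n)) → iter f (toℕ i) x)
  ... | i , j , i<j , eq with <⇒≡+suc i<j
  ...   | c , j≡i+c =
    suc c , s≤s z≤n , period≤n ,
    sym (cancelIterates (toℕ i) (suc c) x px (trans eq (cong (λ t → iter f t x) j≡i+c)))
    where
      period≤n : suc c ≤ n
      period≤n = ≤-trans (subst (suc c ≤_) (sym j≡i+c) (m≤n+m (suc c) (toℕ i))) (≤-pred (toℕ<n j))

module InheritedRotation (G : EmbeddedGraph) (R : Region G) where
  open EmbeddedGraph G public
  open Region R public

  σᴿ : Fin n → Fin n
  σᴿ = σR G R

  InR : Fin n → Set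
  InR d = inR d ≡ true

  FirstInR : Fin n → Fin n → Set
  FirstInR d e = Σ ℕ λ a → (1 ≤ a) × (e ≡ iter σ a d) × InR (iter σ a d) ×
                   (∀ i → 1 ≤ i → i < a → inR (iter σ i d) ≡ false)

  true≢false : true ≢ false
  true≢false ()

  nextR-first : ∀ k d → (Σ ℕ λ i → (1 ≤ i) × (i ≤ k) × InR (iter σ i d)) → FirstInR d (nextR G R k d)
  nextR-first zero d (suc i , _ , () , _)
  nextR-first (suc k) d (i , 1≤i , i≤k , reached) with inR (σ d) in σd∈R
  ... | true = 1 , s≤s z≤n , refl , σd∈R , λ { (suc zero) _ (s≤s ()) ; (suc (suc i)) _ (s≤s ()) }
  ... | false with i
  ...   | suc zero = ⊥-elim (true≢false (trans (sym reached) σd∈R))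
  ...   | suc (suc i′) with nextR-first k (σ d)
                             (suc i′ , s≤s z≤n , ≤-pred i≤k , trans (sym (cong inR (iter-suc′ σ (suc i′) d))) reached)
  ...     | a , _ , found , inR-a , skipped =
    suc a , s≤s z≤n , trans found (sym (iter-suc′ σ a d)) , subst InR (sym (iter-suc′ σ a d)) inR-a , skipped′
    where
      skipped′ : ∀ j → 1 ≤ j → j < suc a → inR (iter σ j d) ≡ false
      skipped′ (suc zero)    _ _         = σd∈R
      skipped′ (suc (suc j)) _ (s≤s j<a) =
        trans (cong inR (iter-suc′ σ (suc j) d)) (skipped (suc j) (s≤s z≤n) j<a)

  nextR-onOrbit : ∀ k d → Σ ℕ λ j → nextR G R k d ≡ iter σ j d
  nextR-onOrbit zero d = 0 , refl
  nextR-onOrbit (suc k) d with inR (σ d)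
  ... | true  = 1 , refl
  ... | false with nextR-onOrbit k (σ d)
  ...   | j , eq = suc j , trans eq (sym (iter-suc′ σ j d))

  -- σ is a permutation, so every dart is σ-periodic and the search of σᴿ
  -- always finds the first R-dart after d
  σ-injective : ∀ x y → σ x ≡ σ y → x ≡ y
  σ-injective x y eq = trans (sym (σ⁻-σ x)) (trans (cong σ⁻ eq) (σ⁻-σ y))

  σR-first : ∀ d → InR d → FirstInR d (σᴿ d)
  σR-first d d∈R with periodicPoint σ (λ _ → ⊤) _ (λ x y _ _ → σ-injective x y) d _
  ... | p , 1≤p , p≤n , σᵖd≡d = nextR-first n d (p , 1≤p , p≤n , subst InR (sym σᵖd≡d) d∈R)

  σR-inR : ∀ d → InR d → InR (σᴿ d)
  σR-inR d d∈R with σR-first d d∈R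
  ... | _ , _ , found , inR-a , _ = subst InR (sym found) inR-a

  σR-vert : ∀ d → vert (σᴿ d) ≡ vert d
  σR-vert d with nextR-onOrbit n d
  ... | j , eq = sym (vert-orb₂ d (σᴿ d) (j , sym eq))

  σR-iter-vert : ∀ j d → vert (iter σᴿ j d) ≡ vert d
  σR-iter-vert zero    d = refl
  σR-iter-vert (suc j) d = trans (σR-vert (iter σᴿ j d)) (σR-iter-vert j d)

  σR-iter-inR : ∀ j d → InR d → InR (iter σᴿ j d)
  σR-iter-inR = iter-preserves σᴿ InR σR-inR

  -- σᴿ is injective on R: the first R-dart after d is reached from no other
  -- R-dart, since the darts in between are not in R
  σR-injective : ∀ d d′ → InR d → InR d′ → σᴿ d ≡ σᴿ d′ → d ≡ d′
  σR-injective d d′ d∈R d′∈R eq with σR-first d d∈R | σR-first d′ d′∈R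
  ... | a , 1≤a , found , _ , skipped | b , 1≤b , found′ , _ , skipped′
    with trans (sym found) (trans eq found′) | <-cmp a b
  ... | σᵃd≡σᵇd′ | tri≈ _ refl _ = iter-injective σ σ-injective a d d′ σᵃd≡σᵇd′
  ... | σᵃd≡σᵇd′ | tri< a<b _ _ with <⇒≡+suc a<b
  ...   | c , refl = ⊥-elim (true≢false (trans (sym d∈R)
                       (trans (cong inR d≡) (skipped′ (suc c) (s≤s z≤n) (skip-bound a c 1≤a)))))
    where
      d≡ : d ≡ iter σ (suc c) d′
      d≡ = iter-injective σ σ-injective a d _ (trans σᵃd≡σᵇd′ (iter-+ σ a (suc c) d′))
  σR-injective d d′ d∈R d′∈R eq | a , 1≤a , _ , _ , skipped | b , 1≤b , _ , _ , _
    | σᵃd≡σᵇd′ | tri> _ _ b<a with <⇒≡+suc b<a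
  ...   | c , refl = ⊥-elim (true≢false (trans (sym d′∈R)
                       (trans (cong inR d′≡) (skipped (suc c) (s≤s z≤n) (skip-bound b c 1≤b)))))
    where
      d′≡ : d′ ≡ iter σ (suc c) d
      d′≡ = iter-injective σ σ-injective b d′ _ (trans (sym σᵃd≡σᵇd′) (iter-+ σ b (suc c) d))

  σR-shift : ∀ d a m → σᴿ d ≡ iter σ a d → iter σ (a + m) d ≡ iter σ m (σᴿ d)
  σR-shift d a m found =
    trans (cong (λ t → iter σ t d) (+-comm a m)) (trans (iter-+ σ m a d) (cong (iter σ m) (sym found)))

  σR-reaches : ∀ fuel k d → k ≤ fuel → InR d → InR (iter σ k d) → Σ ℕ λ j → iter σᴿ j d ≡ iter σ k d
  σR-reaches _          zero    d _ _ _ = 0 , refl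
  σR-reaches zero       (suc k) d () _ _
  σR-reaches (suc fuel) (suc k) d (s≤s k≤fuel) d∈R σᵏd∈R with σR-first d d∈R
  ... | a , 1≤a , found , _ , skipped with <-cmp (suc k) a
  ...   | tri< k<a _ _  = ⊥-elim (true≢false (trans (sym σᵏd∈R) (skipped (suc k) (s≤s z≤n) k<a)))
  ...   | tri≈ _ refl _ = 1 , found
  ...   | tri> _ _ a<k with <⇒≡+suc a<k
  ...     | c , k≡a+c with σR-reaches fuel (suc c) (σᴿ d) (≤-trans (remainder≤ 1≤a k≡a+c) k≤fuel)
                             (σR-inR d d∈R)
                             (subst InR (σR-shift d a (suc c) found) (subst (λ t → InR (iter σ t d)) k≡a+c σᵏd∈R))
  ...       | j , reached =
    suc j , trans (iter-suc′ σᴿ j d)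
              (trans reached (trans (sym (σR-shift d a (suc c) found)) (cong (λ t → iter σ t d) (sym k≡a+c))))

-- index of a minimum of g on {0, …, p}; it picks the canonical (least)
-- dart of a hole
argmin : (g : ℕ → ℕ) → ∀ p → Σ ℕ λ j → (j ≤ p) × (∀ i → i ≤ p → g j ≤ g i)
argmin g zero = 0 , z≤n , λ { zero _ → ≤-refl }
argmin g (suc p) with argmin g p
... | j , j≤p , least with g j ≤? g (suc p)
...   | yes gj≤ = j , ≤-trans j≤p (<⇒≤ ≤-refl) , least′
  where
    least′ : ∀ i → i ≤ suc p → g j ≤ g i
    least′ i i≤ with m≤n⇒m<n∨m≡n i≤
    ... | inj₁ (s≤s i≤p) = least i i≤p
    ... | inj₂ refl      = gj≤
...   | no  gj≰ = suc p , ≤-refl , least′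
  where
    least′ : ∀ i → i ≤ suc p → g (suc p) ≤ g i
    least′ i i≤ with m≤n⇒m<n∨m≡n i≤
    ... | inj₁ (s≤s i≤p) = ≤-trans (<⇒≤ (≰⇒> gj≰)) (least i i≤p)
    ... | inj₂ refl      = ≤-refl

module RegionFaces (G : EmbeddedGraph) (simple : Simple G) (tri : Triangulated G) (R : Region G) where
  open InheritedRotation G R public

  φᴿ : Fin n → Fin n
  φᴿ = φR G R

  α-injective : ∀ x y → α x ≡ α y → x ≡ y
  α-injective x y eq = trans (sym (α-invol x)) (trans (cong α eq) (α-invol y))

  α-inR : ∀ e → InR e → InR (α e)
  α-inR e e∈R = trans (inR-sym e) e∈R

  φR-inR : ∀ e → InR e → InR (φᴿ e)
  φR-inR e e∈R = σR-inR (α e) (α-inR e e∈R)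

  φR-iter-inR : ∀ k e → InR e → InR (iter φᴿ k e)
  φR-iter-inR = iter-preserves φᴿ InR φR-inR

  φR-vert : ∀ e → vert (φᴿ e) ≡ vert (α e)
  φR-vert e = σR-vert (α e)

  φR-injective : ∀ x y → InR x → InR y → φᴿ x ≡ φᴿ y → x ≡ y
  φR-injective x y x∈R y∈R eq = α-injective x y (σR-injective (α x) (α y) (α-inR x x∈R) (α-inR y y∈R) eq)

  φR-periodic : ∀ e → InR e → Σ ℕ λ p → (1 ≤ p) × (p ≤ n) × (iter φᴿ p e ≡ e)
  φR-periodic = periodicPoint φᴿ InR φR-inR φR-injective

  noLoop : ∀ d → vert (α d) ≢ vert d
  noLoop = proj₁ simple

  φ-vert : ∀ d → vert (φ d) ≡ vert (α d)
  φ-vert d = sym (vert-orb₂ (α d) (σ (α d)) (1 , refl))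

  φ³ : ∀ d → φ (φ (φ d)) ≡ d
  φ³ d = proj₁ (tri d)

  vert-φ≢ : ∀ d → vert (φ d) ≢ vert d
  vert-φ≢ d eq = noLoop d (trans (sym (φ-vert d)) eq)

  vert-φφ≢ : ∀ d → vert (φ (φ d)) ≢ vert d
  vert-φφ≢ d eq = noLoop (φ (φ d)) (trans (sym (φ-vert (φ (φ d)))) (trans (cong vert (φ³ d)) (sym eq)))

  OnTriangle : Fin n → Fin n → Set
  OnTriangle d x = (x ≡ d) ⊎ (x ≡ φ d) ⊎ (x ≡ φ (φ d))

  φ-orbit-triangle : ∀ d k → OnTriangle d (iter φ k d)
  φ-orbit-triangle d zero                = inj₁ refl
  φ-orbit-triangle d (suc zero)          = inj₂ (inj₁ refl)
  φ-orbit-triangle d (suc (suc zero))    = inj₂ (inj₂ refl)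
  φ-orbit-triangle d (suc (suc (suc k))) with φ-orbit-triangle d k
  ... | inj₁ eq        = inj₁ (trans (φ³ _) eq)
  ... | inj₂ (inj₁ eq) = inj₂ (inj₁ (trans (φ³ _) eq))
  ... | inj₂ (inj₂ eq) = inj₂ (inj₂ (trans (φ³ _) eq))

  OnTriangle-φ : ∀ d x → OnTriangle d x → OnTriangle d (φ x)
  OnTriangle-φ d x (inj₁ refl)        = inj₂ (inj₁ refl)
  OnTriangle-φ d x (inj₂ (inj₁ refl)) = inj₂ (inj₂ refl)
  OnTriangle-φ d x (inj₂ (inj₂ refl)) = inj₁ (φ³ d)

  OnTriangle-vert : ∀ d x y → OnTriangle d x → OnTriangle d y → vert x ≡ vert y → x ≡ y
  OnTriangle-vert d x y (inj₁ refl)        (inj₁ refl)        _  = refl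
  OnTriangle-vert d x y (inj₁ refl)        (inj₂ (inj₁ refl)) eq = ⊥-elim (vert-φ≢ d (sym eq))
  OnTriangle-vert d x y (inj₁ refl)        (inj₂ (inj₂ refl)) eq = ⊥-elim (vert-φφ≢ d (sym eq))
  OnTriangle-vert d x y (inj₂ (inj₁ refl)) (inj₁ refl)        eq = ⊥-elim (vert-φ≢ d eq)
  OnTriangle-vert d x y (inj₂ (inj₁ refl)) (inj₂ (inj₁ refl)) _  = refl
  OnTriangle-vert d x y (inj₂ (inj₁ refl)) (inj₂ (inj₂ refl)) eq = ⊥-elim (vert-φ≢ (φ d) (sym eq))
  OnTriangle-vert d x y (inj₂ (inj₂ refl)) (inj₁ refl)        eq = ⊥-elim (vert-φφ≢ d eq)
  OnTriangle-vert d x y (inj₂ (inj₂ refl)) (inj₂ (inj₁ refl)) eq = ⊥-elim (vert-φ≢ (φ d) eq)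
  OnTriangle-vert d x y (inj₂ (inj₂ refl)) (inj₂ (inj₂ refl)) _  = refl

  RTriangle : Fin n → Set
  RTriangle d = (φᴿ d ≡ φ d) × (φᴿ (φ d) ≡ φ (φ d)) × (φᴿ (φ (φ d)) ≡ d)

  RTriangle? : ∀ d → Dec (RTriangle d)
  RTriangle? d = (φᴿ d Fin.≟ φ d) ×-dec ((φᴿ (φ d) Fin.≟ φ (φ d)) ×-dec (φᴿ (φ (φ d)) Fin.≟ d))

  RTriangle-φR : ∀ d → RTriangle d → RTriangle (φᴿ d)
  RTriangle-φR d (e₁ , e₂ , e₃) =
    subst RTriangle (sym e₁) (e₂ , trans e₃ (sym (φ³ d)) , trans (cong φᴿ (φ³ d)) e₁)

  -- along a natural face, φᴿ agrees with φ, as both lead to the corner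
  -- with the vertex of α x
  natural⇒RTriangle : ∀ d → Natural G R d → RTriangle d
  natural⇒RTriangle d natural = e₁ , e₂ , trans e₃ (φ³ d)
    where
      agrees : ∀ k x → iter φᴿ k d ≡ x → OnTriangle d x → φᴿ x ≡ φ x
      agrees k x reach x-on with proj₁ (natural (φᴿ x)) (suc k , cong φᴿ reach)
      ... | j , φʲd≡ = OnTriangle-vert d (φᴿ x) (φ x)
                         (subst (OnTriangle d) φʲd≡ (φ-orbit-triangle d j)) (OnTriangle-φ d x x-on)
                         (trans (φR-vert x) (sym (φ-vert x)))
      e₁ : φᴿ d ≡ φ d
      e₁ = agrees 0 d refl (inj₁ refl)
      e₂ : φᴿ (φ d) ≡ φ (φ d)
      e₂ = agrees 1 (φ d) e₁ (inj₂ (inj₁ refl))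
      e₃ : φᴿ (φ (φ d)) ≡ φ (φ (φ d))
      e₃ = agrees 2 (φ (φ d)) (trans (cong φᴿ e₁) e₂) (inj₂ (inj₂ refl))

  onHole : ∀ e → InR e → ¬ RTriangle e → Σ (Fin n) λ h → HoleRep G R h × SameOrbit φᴿ h e
  onHole e e∈R ¬tri with φR-periodic e e∈R
  ... | suc p , _ , _ , periodic with argmin (λ k → toℕ (iter φᴿ k e)) p
  ...   | j , _ , least = h , (φR-iter-inR j e e∈R , minimal , ¬natural) , j * p , back
    where
      h = iter φᴿ j e
      back : iter φᴿ (j * p) h ≡ e
      back = iter-cycle-forward φᴿ p e periodic j 0
      minimal : ∀ e′ → SameOrbit φᴿ h e′ → toℕ h ≤ toℕ e′
      minimal e′ (k , refl) =
        subst (λ t → toℕ h ≤ toℕ t) (sym φᵏh≡) (least ((k + j) % suc p) (≤-pred (m%n<n (k + j) (suc p))))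
        where
          φᵏh≡ : iter φᴿ k h ≡ iter φᴿ ((k + j) % suc p) e
          φᵏh≡ = trans (sym (iter-+ φᴿ k j e)) (iter-period-% φᴿ (suc p) e periodic (k + j))
      ¬natural : ¬ Natural G R h
      ¬natural natural =
        ¬tri (subst RTriangle back (iter-preserves φᴿ RTriangle RTriangle-φR (j * p) h (natural⇒RTriangle h natural)))

module Completion (G : EmbeddedGraph) (simple : Simple G) (tri : Triangulated G) (R : Region G) where
  open RegionFaces G simple tri R public

  Vertex′ : Set
  Vertex′ = Fin V ⊎ Fin n

  Vtx′ : Vertex′ → Set
  Vtx′ = R'Vtx G R

  Adj′ : Vertex′ → Vertex′ → Set
  Adj′ = R'Adj G R

  Avoiding : Vertex′ → Vertex′ → Vertex′ → Set
  Avoiding = WalkAvoiding Adj′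

  _≟′_ : DecidableEquality Vertex′
  _≟′_ = ≡-dec Fin._≟_ Fin._≟_

  across : Fin n → Fin V
  across d = vert (α d)

  inj₁-≢ : {a b : Fin V} → a ≢ b → inj₁ {B = Fin n} a ≢ inj₁ b
  inj₁-≢ a≢b eq = a≢b (inj₁-injective eq)

  Adj′-sym : ∀ {a b} → Adj′ a b → Adj′ b a
  Adj′-sym {inj₁ _} {inj₁ _} (d , d∈R , du , dv) = α d , α-inR d d∈R , dv , trans (cong vert (α-invol d)) du
  Adj′-sym {inj₁ _} {inj₂ _} on = on
  Adj′-sym {inj₂ _} {inj₁ _} on = on

  Adj′-irreflexive : ∀ a → ¬ Adj′ a a
  Adj′-irreflexive (inj₁ _) (d , _ , du , du′) = noLoop d (trans du′ (sym du))
  Adj′-irreflexive (inj₂ _) ()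

  holeDart-inR : ∀ {h e} → HoleRep G R h → SameOrbit φᴿ h e → InR e
  holeDart-inR {h} hole (k , refl) = φR-iter-inR k h (proj₁ hole)

  vert-φR≢ : ∀ x → vert (φᴿ x) ≢ vert x
  vert-φR≢ x eq = noLoop x (trans (sym (φR-vert x)) eq)

  faceWalk : ∀ m e → InR e → Σ (List (Fin V)) λ xs → Walk (RAdj G R) xs (vert e) (vert (iter φᴿ m e))
  faceWalk zero    e _   = _ , single _
  faceWalk (suc m) e e∈R with faceWalk m (φᴿ e) (φR-inR e e∈R)
  ... | xs , w = vert e ∷ xs , step (e , e∈R , refl , sym (φR-vert e))
                                    (subst (λ t → Walk (RAdj G R) xs _ (vert t)) (sym (iter-suc′ φᴿ m e)) w)

  liftWalk : ∀ {xs a b} → Walk (RAdj G R) xs a b → Walk Adj′ (map inj₁ xs) (inj₁ a) (inj₁ b)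
  liftWalk (single _) = single _
  liftWalk (step e w) = step e (liftWalk w)

  artificial∉lift : ∀ {h : Fin n} (xs : List (Fin V)) → inj₂ h ∉ map inj₁ xs
  artificial∉lift (x ∷ xs) (here ())
  artificial∉lift (x ∷ xs) (there m) = artificial∉lift xs m

  aroundHole : ∀ h x y → OnHole G R h x → OnHole G R h y → Avoiding (inj₂ h) (inj₁ x) (inj₁ y)
  aroundHole h x y (hole , _ , (i , refl) , refl) (_ , _ , (j , refl) , refl) with φR-periodic h (proj₁ hole)
  ... | suc p , _ , _ , periodic with faceWalk (j + i * p) (iter φᴿ i h) (φR-iter-inR i h (proj₁ hole))
  ...   | xs , w = map inj₁ xs ,
                   subst (λ t → Walk Adj′ (map inj₁ xs) _ (inj₁ (vert t)))
                         (iter-cycle-forward φᴿ p h periodic i j) (liftWalk w) ,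
                   artificial∉lift xs

  -- In the R-face through x, the vertices of x and of φᴿ² x are joined
  -- without visiting the vertex of φᴿ x: by an edge of R if the face is a
  -- triangle of Ḡ, through x_h if it is a hole h.
  faceCorner : ∀ x → InR x → Avoiding (inj₁ (vert (φᴿ x))) (inj₁ (vert x)) (inj₁ (vert (φᴿ (φᴿ x))))
  faceCorner x x∈R with RTriangle? x
  ... | yes (e₁ , e₂ , _) =
    _ , step edge (single _) ,
    λ { (here eq) → inj₁-≢ (vert-φR≢ x) eq
      ; (there (here eq)) → inj₁-≢ (vert-φR≢ (φᴿ x)) (sym eq)
      ; (there (there ())) }
    where
      f∈R : InR (φᴿ (φᴿ x))
      f∈R = φR-inR _ (φR-inR x x∈R)
      φf≡x : φ (φᴿ (φᴿ x)) ≡ x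
      φf≡x = trans (cong φ (trans (cong φᴿ e₁) e₂)) (φ³ x)
      edge : RAdj G R (vert x) (vert (φᴿ (φᴿ x)))
      edge = α (φᴿ (φᴿ x)) , α-inR _ f∈R , trans (sym (φ-vert _)) (cong vert φf≡x) , cong vert (α-invol _)
  ... | no ¬tri with onHole x x∈R ¬tri
  ...   | h , hole , (k , φᵏh≡x) =
    _ , step {w = inj₂ h} (hole , x , (k , φᵏh≡x) , refl) (step (hole , φᴿ (φᴿ x) , (suc (suc k) , cong φᴿ (cong φᴿ φᵏh≡x)) , refl) (single _)) ,
    λ { (here eq) → inj₁-≢ (vert-φR≢ x) eq
      ; (there (here ()))
      ; (there (there (here eq))) → inj₁-≢ (vert-φR≢ (φᴿ x)) (sym eq)
      ; (there (there (there ()))) }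

  -- the far ends of consecutive darts e, σᴿ e of R at a vertex are joined
  -- avoiding that vertex (the corner of the R-face of α e)
  rotationCorner : ∀ e → InR e → Avoiding (inj₁ (vert e)) (inj₁ (across e)) (inj₁ (across (σᴿ e)))
  rotationCorner e e∈R =
    subst₂ (λ v t → Avoiding (inj₁ v) (inj₁ (across e)) (inj₁ t)) centre far (faceCorner (α e) (α-inR e e∈R))
    where
      φR-αe : φᴿ (α e) ≡ σᴿ e
      φR-αe = cong σᴿ (α-invol e)
      centre : vert (φᴿ (α e)) ≡ vert e
      centre = trans (cong vert φR-αe) (σR-vert e)
      far : vert (φᴿ (φᴿ (α e))) ≡ across (σᴿ e)
      far = trans (cong (λ t → vert (φᴿ t)) φR-αe) (φR-vert (σᴿ e))

  rotationWalk : ∀ j e → InR e → Avoiding (inj₁ (vert e)) (inj₁ (across e)) (inj₁ (across (iter σᴿ j e)))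
  rotationWalk zero    e e∈R = _ , single _ , λ { (here eq) → inj₁-≢ (noLoop e) (sym eq) ; (there ()) }
  rotationWalk (suc j) e e∈R =
    rotationWalk j e e∈R
    ++ᴬ subst (λ v → Avoiding (inj₁ v) (inj₁ (across (iter σᴿ j e))) (inj₁ (across (iter σᴿ (suc j) e))))
              (σR-iter-vert j e) (rotationCorner (iter σᴿ j e) (σR-iter-inR j e e∈R))

  aroundVertex : ∀ e e′ → InR e → InR e′ → vert e ≡ vert e′ →
    Avoiding (inj₁ (vert e)) (inj₁ (across e)) (inj₁ (across e′))
  aroundVertex e e′ e∈R e′∈R same with vert-orb₁ e e′ same
  ... | k , σᵏe≡e′ with σR-reaches k k e ≤-refl e∈R (subst InR (sym σᵏe≡e′) e′∈R)
  ...   | j , σRʲe≡ = subst (λ t → Avoiding _ _ (inj₁ (across t))) (trans σRʲe≡ σᵏe≡e′) (rotationWalk j e e∈R)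

  Attached : Fin V → Vertex′ → Set
  Attached v a = Σ (Fin n) λ d → InR d × (vert d ≡ v) × Avoiding (inj₁ v) (inj₁ (across d)) a

  -- a real neighbour is the far end of its edge; an artificial one x_h is
  -- joined to the far end of the next dart of h
  attached : ∀ v a → Adj′ (inj₁ v) a → Attached v a
  attached v (inj₁ b) (d , d∈R , refl , refl) =
    d , d∈R , refl , (_ , single _ , λ { (here eq) → inj₁-≢ (noLoop d) (sym eq) ; (there ()) })
  attached v (inj₂ h) (hole , e , (k , φᵏh≡e) , refl) =
    e , holeDart-inR hole (k , φᵏh≡e) , refl ,
    (_ , step (hole , φᴿ e , (suc k , cong φᴿ φᵏh≡e) , φR-vert e) (single _) ,
     λ { (here eq) → inj₁-≢ (noLoop e) (sym eq) ; (there (here ())) ; (there (there ())) })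

  bypass : ∀ w a b → Adj′ a w → Adj′ w b → Avoiding w a b
  bypass (inj₁ v) a b a~v v~b with attached v a (Adj′-sym a~v) | attached v b v~b
  ... | d , d∈R , refl , d→a | d′ , d′∈R , d′v , d′→b =
    reverseAvoiding Adj′-sym d→a ++ᴬ (aroundVertex d d′ d∈R d′∈R (sym d′v) ++ᴬ d′→b)
  bypass (inj₂ h) (inj₁ x) (inj₁ y) x~h h~y = aroundHole h x y x~h h~y

  avoidVertex : ∀ {xs} w x y → x ≢ w → y ≢ w → Walk Adj′ xs x y → Avoiding w x y
  avoidVertex w x .x x≢w _ (single .x) = _ , single x , λ { (here eq) → x≢w (sym eq) ; (there ()) }
  avoidVertex w x y x≢w y≢w (step {w = z} e rest) with z ≟′ w
  ... | no z≢w with avoidVertex w z y z≢w y≢w rest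
  ...   | ys , walk , w∉ys = x ∷ ys , step e walk , λ { (here eq) → x≢w (sym eq) ; (there m) → w∉ys m }
  avoidVertex w x y x≢w y≢w (step e (single _))              | yes refl = ⊥-elim (y≢w refl)
  avoidVertex w x y x≢w y≢w (step e (step {w = z′} e′ rest)) | yes refl =
    bypass w x z′ e e′ ++ᴬ avoidVertex w z′ y (λ eq → Adj′-irreflexive w (subst (Adj′ w) eq e′)) y≢w rest

  adj-vertex : ∀ {a b} → Adj′ a b → Vtx′ b
  adj-vertex {inj₁ _} {inj₁ _} (d , d∈R , _ , db) = α d , α-inR d d∈R , db
  adj-vertex {inj₂ _} {inj₁ _} (hole , e , orbit , eb) = e , holeDart-inR hole orbit , eb
  adj-vertex {inj₁ _} {inj₂ _} (hole , _) = hole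

  anchor : ∀ x → Vtx′ x → Σ (Fin V) λ a → RVertex G R a × Σ (List Vertex′) λ xs → Walk Adj′ xs (inj₁ a) x
  anchor (inj₁ a) a∈R  = a , a∈R , _ , single _
  anchor (inj₂ h) hole = vert h , (h , proj₁ hole , refl) , _ , step (hole , h , (0 , refl) , refl) (single _)

  connected : ConnectedRegion G R → Connected Vtx′ Adj′
  connected conn x y vx vy with anchor x vx | anchor y vy
  ... | a , a∈R , _ , a→x | b , b∈R , _ , b→y with conn a b a∈R b∈R | reverseWalk Adj′-sym a→x
  ... | _ , a→b | _ , x→a , _ with concatWalks (liftWalk a→b) b→y
  ... | _ , a→y , _ with concatWalks x→a a→y
  ... | _ , x→y , _ = _ , x→y

  noCutVertex : ConnectedRegion G R → NoCutVertex Vtx′ Adj′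
  noCutVertex conn w x y vx vy x≢w y≢w = avoidVertex w x y x≢w y≢w (proj₂ (connected conn x y vx vy))

  -- an edge from a real vertex to x_h: the far end of the hole dart
  thirdVertex-hole : ∀ a h → OnHole G R h a → Σ Vertex′ λ z → Vtx′ z × z ≢ inj₁ a × z ≢ inj₂ h
  thirdVertex-hole a h (hole , e , orbit , refl) =
    inj₁ (across e) , (α e , α-inR e (holeDart-inR hole orbit) , refl) , inj₁-≢ (noLoop e) , (λ ())

  -- an edge of R: the third corner of its triangle, or the hole beside it
  thirdVertex : ∀ u v → Adj′ u v → Σ Vertex′ λ z → Vtx′ z × z ≢ u × z ≢ v
  thirdVertex (inj₁ a) (inj₁ b) (d , d∈R , refl , refl) with RTriangle? d
  ... | yes (e₁ , e₂ , _) =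
    inj₁ (vert (φ (φ d))) , (φ (φ d) , subst InR (trans (cong φᴿ e₁) e₂) (φR-inR _ (φR-inR d d∈R)) , refl) ,
    inj₁-≢ (vert-φφ≢ d) , inj₁-≢ (λ eq → vert-φ≢ (φ d) (trans eq (sym (φ-vert d))))
  ... | no ¬tri with onHole d d∈R ¬tri
  ...   | h , hole , _ = inj₂ h , hole , (λ ()) , (λ ())
  thirdVertex (inj₁ a) (inj₂ h) a~h = thirdVertex-hole a h a~h
  thirdVertex (inj₂ h) (inj₁ a) h~a with thirdVertex-hole a h h~a
  ... | z , vz , z≢a , z≢h = z , vz , z≢h , z≢a

lemma3 : (G : EmbeddedGraph) → Simple G → Planar G → Triangulated G →
         Biconnected (λ _ → ⊤) (EmbeddedGraph.Adj G) →
         (R : Region G) → ConnectedRegion G R →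
         Biconnected (R'Vtx G R) (R'Adj G R)
lemma3 G simple _ tri _ R conn =
  Whitney.biconnected _≟′_ Vtx′ Adj′ adj-vertex (noCutVertex conn) thirdVertex (connected conn)
  where open Completion G simple tri R
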